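{- For every instance of the $k$-server problem on an HST $T$, the optimal value of the linear program $\mathfrak{M}$ below is at most the cost of an optimal solution to the instance. The LP $\mathfrak{M}$ has variables $x(v,t)\ge 0$ for every non-root node $v$ of $T$ and every timestep $t\in\mathfrak{T}$, objective $\min\sum_{v\ne \mathbbm{r}}\sum_{t} c_v\,x(v,t)$, and for every pair $(A,\boldsymbol{\tau})$ the constraint $$\sum_{v\in T^A,\,v\neq \mathbbm{r}} x\big(v,(\tau_v,\tau_{p(v)}]\big)\ \ge\ |A|-k,$$ where $A$ is a set of leaves and $\boldsymbol{\tau}=\{\tau_u\}_{u\in T^A}$ assigns a timestep to each node of $T^A$ such that (i) each leaf $\ell\in A$ has a request at time $\lfloor\tau_\ell\rfloor$, and (ii) for each internal node $u\in T^A$, $\tau_u=\max_{\ell\in A\cap T_u}\tau_\ell$.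
   Context: $T$ is a rooted tree with root $\mathbbm{r}$; for a non-root node $v$, $p(v)$ is its parent and $c_v>0$ is the length of the edge $(v,p(v))$ (in a $\lambda$-HST, $c_v=\lambda^{\mathrm{level}(v)}$). $T_u$ is the subtree rooted at $u$. For a set $A$ of nodes, $T^A$ is the minimal subtree containing the root and $A$ (the nodes of $A$ and all their ancestors). In the $k$-server problem on $T$, requests $(\ell_q,q)$ arrive at leaves $\ell_q$ at distinct increasing integer request times $q$, and a solution must have one of its $k$ servers at $\ell_q$ at time $q$; its cost is the total distance moved by servers. The set of timesteps $\mathfrak{T}$ consists of the values $q+i\eta$ ($i=0,1,\dots$) for a small $\eta\in(0,1)$, lying between consecutive request times; $\lfloor\tau\rfloor$ denotes the request time $q$ with $\tau\in[q,q+1)$. For an interval $I$, $x(v,I)=\sum_{t\in I\cap\mathfrak{T}}x(v,t)$.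
   Formalization: The HST parameter λ and the edge lengths $c_v$ are rational, and the LP variables $x(v,t)$ are taken in ℚ. -}

module Defs where

open import Data.Nat as ℕ using (ℕ; zero; suc)
open import Data.Fin as Fin using (Fin; zero; suc; inject₁)
open import Data.Fin.Subset using (Subset; _∈_; ∣_∣)
open import Data.Bool using (Bool; true; false; if_then_else_; _∧_; _∨_; _xor_; not)
open import Data.Product using (Σ; ∃; _×_; _,_; proj₁; proj₂)
open import Data.Integer as ℤ using (ℤ; +_)
open import Data.Rational as ℚ using (ℚ; 0ℚ; 1ℚ; _+_; _*_; _-_; _≤_; _<_)
open import Data.Vec using (lookup)
open import Relation.Nullary using (¬_; does)
open import Relation.Binary.PropositionalEquality using (_≡_; _≢_)
open import Function using (_∘_)

sumFin : (m : ℕ) → (Fin m → ℚ) → ℚ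
sumFin zero    f = 0ℚ
sumFin (suc m) f = f zero + sumFin m (f ∘ suc)

pow : ℚ → ℕ → ℚ
pow q zero    = 1ℚ
pow q (suc m) = q * pow q m

iter : {A : Set} → (A → A) → ℕ → A → A
iter f zero    a = a
iter f (suc m) a = f (iter f m a)

-- Rooted trees on the node set Fin n.
-- parent of the root is junk; depth certifies acyclicity: every parent
-- chain strictly decreases depth and only the root has depth 0.

record Tree : Set where
  field
    n            : ℕ
    root         : Fin n
    parent       : Fin n → Fin n
    depth        : Fin n → ℕ
    depth-root   : depth root ≡ 0
    depth-parent : ∀ v → v ≢ root → depth v ≡ suc (depth (parent v))

module _ (T : Tree) where
  open Tree T

  Node : Set
  Node = Fin n

  isRoot : Node → Bool
  isRoot v = does (v Fin.≟ root)

  -- u is an ancestor of v or u = v  (i.e. v ∈ T_u)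
  isAnc : Node → Node → Bool
  isAnc u v = does (iter parent (depth v ℕ.∸ depth u) v Fin.≟ u)
            ∧ does (depth u ℕ.≤? depth v)

  Leaf : Node → Set
  Leaf v = ∀ w → w ≢ root → parent w ≢ v

  inTA : Subset n → Node → Bool
  inTA A v = anyFin n (λ ℓ → lookup A ℓ ∧ isAnc v ℓ)
    where
    anyFin : (m : ℕ) → (Fin m → Bool) → Bool
    anyFin zero    f = false
    anyFin (suc m) f = f zero ∨ anyFin m (f ∘ suc)

  sel : Bool → ℚ → ℚ
  sel b q = if b then q else 0ℚ

  -- tree distance with edge lengths c (c v = length of edge (v, p(v)))
  dist : (Node → ℚ) → Node → Node → ℚ
  dist c u v = sumFin n (λ w → sel (not (isRoot w) ∧ (isAnc w u xor isAnc w v)) (c w))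

  IsHST : (Node → ℚ) → Set
  IsHST c = Σ ℚ λ lam → (1ℚ < lam) × Σ (Node → ℕ) λ level →
              (∀ v → v ≢ root → level (parent v) ≡ suc (level v))
            × (∀ v → v ≢ root → c v ≡ pow lam (level v))

  -- Instance: R requests, request j at leaf req j (request times are
  -- distinct increasing integers; only their order matters).
  -- Solution with k servers: configurations conf 0 (initial), conf (j+1)
  -- after serving request j.

  record Solution (k R : ℕ) (req : Fin R → Node) : Set where
    field
      conf   : Fin (suc R) → Fin k → Node
      serves : ∀ j → ∃ λ s → conf (suc j) s ≡ req j

  cost : (c : Node → ℚ) {k R : ℕ} {req : Fin R → Node} → Solution k R req → ℚ
  cost c {k} {R} S = sumFin R (λ j → sumFin k (λ s →
      dist c (Solution.conf S (inject₁ j) s) (Solution.conf S (suc j) s)))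

  -- Timesteps: q_j + i η with i < N  (N = number of timesteps per unit,
  -- N = ⌈1/η⌉); represented as (j , i), ordered lexicographically;
  -- ⌊(j , i)⌋ = request time of request j.

  Timestep : ℕ → ℕ → Set
  Timestep R N = Fin R × Fin N

  _<ₜ_ : {R N : ℕ} → Timestep R N → Timestep R N → Bool
  (j , i) <ₜ (j' , i') = does (j Fin.<? j') ∨ (does (j Fin.≟ j') ∧ does (i Fin.<? i'))

  _≤ₜ_ : {R N : ℕ} → Timestep R N → Timestep R N → Bool
  a ≤ₜ b = not (b <ₜ a)

  LPVar : ℕ → ℕ → Set
  LPVar R N = Node → Timestep R N → ℚ

  xInt : {R N : ℕ} → LPVar R N → Node → Timestep R N → Timestep R N → ℚ
  xInt {R} {N} x v a b = sumFin R (λ j → sumFin N (λ i →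
      sel ((a <ₜ (j , i)) ∧ ((j , i) ≤ₜ b)) (x v (j , i))))

  objective : (c : Node → ℚ) {R N : ℕ} → LPVar R N → ℚ
  objective c {R} {N} x = sumFin n (λ v → sel (not (isRoot v))
      (sumFin R (λ j → sumFin N (λ i → c v * x v (j , i)))))

  ValidPair : {R N : ℕ} → (Fin R → Node) → Subset n → (Node → Timestep R N) → Set
  ValidPair req A τ =
      (∀ ℓ → ℓ ∈ A → Leaf ℓ)
    × (∀ ℓ → ℓ ∈ A → req (proj₁ (τ ℓ)) ≡ ℓ)
    × (∀ u → inTA A u ≡ true → ¬ Leaf u →
          (∀ ℓ → ℓ ∈ A → isAnc u ℓ ≡ true → (τ ℓ ≤ₜ τ u) ≡ true)
        × (∃ λ ℓ → ℓ ∈ A × isAnc u ℓ ≡ true × τ ℓ ≡ τ u))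

  constraintLHS : {R N : ℕ} → LPVar R N → Subset n → (Node → Timestep R N) → ℚ
  constraintLHS x A τ = sumFin n (λ v →
      sel (not (isRoot v) ∧ inTA A v) (xInt x v (τ v) (τ (parent v))))

  Feasible : (k : ℕ) {R N : ℕ} → (Fin R → Node) → LPVar R N → Set
  Feasible k req x =
      (∀ v t → 0ℚ ≤ x v t)
    × (∀ A τ → ValidPair req A τ →
          ℚ._/_ (+ ∣ A ∣ ℤ.- + k) 1 ≤ constraintLHS x A τ)

module Submission where

-- Let x(v, ·) carry, on the first timestep after request j, the number of servers that cross the
-- edge (v, p(v)) while the solution serves request j; its objective is exactly the cost of the
-- solution. Fix a constraint (A, τ) and let m_v(t) be the number of servers in T_v just after the
-- request at ⌊t⌋ is served. Along an edge of T^A we have τ_v ≤ τ_p(v), and a server inside T_v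
-- at time τ_v is either inside at time τ_p(v) or crosses the edge in between, so
-- m_v(τ_v) ≤ x(v, (τ_v, τ_p(v)]) + m_v(τ_p(v)). Summing over the non-root nodes of T^A, the terms
-- m_v(τ_p(v)) of the children v of u add up to at most m_u(τ_u), as their subtrees are disjoint.
-- What remains is m_ℓ(τ_ℓ) ≥ 1 for ℓ ∈ A, because the request at ℓ is being served, against
-- m_root ≤ k, whence |A| - k ≤ Σ x(v, (τ_v, τ_p(v)]).

open import Defs
open import Data.Nat using (ℕ; _≤_)
open import Data.Fin using (Fin)
open import Data.Product using (Σ; _×_)
open import Data.Rational using (ℚ) renaming (_≤_ to _≤ℚ_)

open import Algebra.Bundles using (CommutativeMonoid)
open import Data.Bool using (Bool; true; false; if_then_else_; _∧_; _∨_; not; _xor_)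
open import Data.Bool.Properties using (∨-zeroʳ; ∨-identityʳ; ∧-zeroʳ; ∧-conicalˡ; ∧-conicalʳ)
open import Data.Empty using (⊥-elim)
open import Data.Fin as Fin using (zero; suc)
open import Data.Fin.Properties using (suc-injective)
open import Data.Fin.Subset using (Subset; _∈_; ∣_∣)
import Data.Integer as ℤ
import Data.Integer.Properties as ℤ
open import Data.Nat as ℕ using (zero; suc; _<_)
open import Data.Nat.Coprimality using (1-coprimeTo) renaming (sym to Coprime-sym)
import Data.Nat.Properties as ℕ
open import Data.Product using (∃; _,_; proj₁; proj₂)
open import Data.Rational using (mkℚ; 0ℚ; 1ℚ; _+_; _*_; _/_; -_)
open import Data.Rational.Properties
open import Algebra.Properties.CommutativeSemigroup
  (CommutativeMonoid.commutativeSemigroup +-0-commutativeMonoid) using (interchange)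
open import Algebra.Properties.Group +-0-group using (//-rightDividesʳ)
open import Data.Vec using ([]; _∷_; lookup)
open import Data.Vec.Properties using (lookup⇒[]=)
open import Function using (_∘_; case_of_)
open import Relation.Binary.PropositionalEquality
open import Relation.Nullary using (Dec; yes; no; does; ¬_)
open import Relation.Nullary.Decidable using (dec-true; dec-false)

∨-∧-false : ∀ x y → x ∨ (y ∧ false) ≡ x
∨-∧-false x y = trans (cong (x ∨_) (∧-zeroʳ y)) (∨-identityʳ x)

not-∨ˡ : ∀ x {y} → not (x ∨ y) ≡ true → not x ≡ true
not-∨ˡ false _ = refl

from-does : ∀ {P : Set} (d : Dec P) → does d ≡ true → P
from-does (yes p) _ = p

from-not-does : ∀ {P : Set} (d : Dec P) → not (does d) ≡ true → ¬ P
from-not-does (no ¬p) _ = ¬p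

-- `when b q` is Defs' `sel T b q`, freed from its unused tree argument.
when : Bool → ℚ → ℚ
when b q = if b then q else 0ℚ

𝟙 : Bool → ℚ
𝟙 b = when b 1ℚ

0≤1 : 0ℚ ≤ℚ 1ℚ
0≤1 = nonNegative⁻¹ 1ℚ

when-zero : ∀ b → when b 0ℚ ≡ 0ℚ
when-zero true  = refl
when-zero false = refl

when-when : ∀ a b q → when a (when b q) ≡ when (a ∧ b) q
when-when true  b q = refl
when-when false b q = refl

when-*-𝟙 : ∀ a b q → when a (q * 𝟙 b) ≡ when (a ∧ b) q
when-*-𝟙 false b     q = refl
when-*-𝟙 true  true  q = *-identityʳ q
when-*-𝟙 true  false q = *-zeroʳ q

when-split : ∀ b c q → when b q ≡ when (c ∧ b) q + when (not c ∧ b) q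
when-split b true  q = sym (+-identityʳ (when b q))
when-split b false q = sym (+-identityˡ (when b q))

when-nonneg : ∀ b {q} → 0ℚ ≤ℚ q → 0ℚ ≤ℚ when b q
when-nonneg true  0≤q = 0≤q
when-nonneg false _   = ≤-refl

𝟙-nonneg : ∀ b → 0ℚ ≤ℚ 𝟙 b
𝟙-nonneg b = when-nonneg b 0≤1

when-≤ : ∀ b {q} → 0ℚ ≤ℚ q → when b q ≤ℚ q
when-≤ true  _   = ≤-refl
when-≤ false 0≤q = 0≤q

when-mono-≤ : ∀ b {p q} → p ≤ℚ q → when b p ≤ℚ when b q
when-mono-≤ true  p≤q = p≤q
when-mono-≤ false _   = ≤-refl

when-⇒-≤ : ∀ a b {q} → 0ℚ ≤ℚ q → (a ≡ true → b ≡ true) → when a q ≤ℚ when b q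
when-⇒-≤ true  b 0≤q a⇒b rewrite a⇒b refl = ≤-refl
when-⇒-≤ false b 0≤q _   = when-nonneg b 0≤q

when-≤-+ : ∀ b {p q r} → (b ≡ true → p ≤ℚ q + r) → when b p ≤ℚ when b q + when b r
when-≤-+ true  p≤q+r = p≤q+r refl
when-≤-+ false _     = ≤-reflexive (sym (+-identityˡ 0ℚ))

p≤q⇒p≤r+q : ∀ {p q} r → 0ℚ ≤ℚ r → p ≤ℚ q → p ≤ℚ r + q
p≤q⇒p≤r+q {q = q} r 0≤r p≤q =
  ≤-trans p≤q (≤-trans (≤-reflexive (sym (+-identityˡ q))) (+-monoˡ-≤ q 0≤r))

sumFin-cong : ∀ m {f g : Fin m → ℚ} → (∀ i → f i ≡ g i) → sumFin m f ≡ sumFin m g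
sumFin-cong zero    f≗g = refl
sumFin-cong (suc m) f≗g = cong₂ _+_ (f≗g zero) (sumFin-cong m (f≗g ∘ suc))

sumFin-mono : ∀ m {f g : Fin m → ℚ} → (∀ i → f i ≤ℚ g i) → sumFin m f ≤ℚ sumFin m g
sumFin-mono zero    f≤g = ≤-refl
sumFin-mono (suc m) f≤g = +-mono-≤ (f≤g zero) (sumFin-mono m (f≤g ∘ suc))

sumFin-zero : ∀ m → sumFin m (λ _ → 0ℚ) ≡ 0ℚ
sumFin-zero zero    = refl
sumFin-zero (suc m) = trans (+-identityˡ _) (sumFin-zero m)

sumFin-+ : ∀ m (f g : Fin m → ℚ) → sumFin m (λ i → f i + g i) ≡ sumFin m f + sumFin m g
sumFin-+ zero    f g = sym (+-identityˡ 0ℚ)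
sumFin-+ (suc m) f g = trans (cong (f zero + g zero +_) (sumFin-+ m (f ∘ suc) (g ∘ suc)))
                             (interchange (f zero) (g zero) _ _)

sumFin-swap : ∀ m p (f : Fin m → Fin p → ℚ) →
              sumFin m (λ i → sumFin p (f i)) ≡ sumFin p (λ j → sumFin m (λ i → f i j))
sumFin-swap zero    p f = sym (sumFin-zero p)
sumFin-swap (suc m) p f = trans (cong (sumFin p (f zero) +_) (sumFin-swap m p (f ∘ suc)))
                                (sym (sumFin-+ p (f zero) _))

sumFin-*ˡ : ∀ m c (f : Fin m → ℚ) → c * sumFin m f ≡ sumFin m (λ i → c * f i)
sumFin-*ˡ zero    c f = *-zeroʳ c
sumFin-*ˡ (suc m) c f =
  trans (*-distribˡ-+ c (f zero) _) (cong (c * f zero +_) (sumFin-*ˡ m c (f ∘ suc)))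

when-sumFin : ∀ m b (f : Fin m → ℚ) → when b (sumFin m f) ≡ sumFin m (λ i → when b (f i))
when-sumFin m true  f = refl
when-sumFin m false f = sym (sumFin-zero m)

sumFin-nonneg : ∀ m {f : Fin m → ℚ} → (∀ i → 0ℚ ≤ℚ f i) → 0ℚ ≤ℚ sumFin m f
sumFin-nonneg m 0≤f = ≤-trans (≤-reflexive (sym (sumFin-zero m))) (sumFin-mono m 0≤f)

term≤sumFin : ∀ m {f : Fin m → ℚ} → (∀ i → 0ℚ ≤ℚ f i) → ∀ i → f i ≤ℚ sumFin m f
term≤sumFin (suc m) {f} 0≤f zero    = ≤-trans (≤-reflexive (sym (+-identityʳ (f zero))))
                                              (+-monoʳ-≤ (f zero) (sumFin-nonneg m (0≤f ∘ suc)))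
term≤sumFin (suc m) {f} 0≤f (suc i) = p≤q⇒p≤r+q (f zero) (0≤f zero) (term≤sumFin m (0≤f ∘ suc) i)

sumFin-when-≟ : ∀ m (a : Fin m) (f : Fin m → ℚ) →
                sumFin m (λ i → when (does (i Fin.≟ a)) (f i)) ≡ f a
sumFin-when-≟ (suc m) zero    f = trans (cong (f zero +_) (sumFin-zero m)) (+-identityʳ (f zero))
sumFin-when-≟ (suc m) (suc a) f = trans (+-identityˡ _) (sumFin-when-≟ m a (f ∘ suc))

sumFin-when-split : ∀ m (b c : Fin m → Bool) (f : Fin m → ℚ) →
                    sumFin m (λ i → when (b i) (f i))
                    ≡ sumFin m (λ i → when (c i ∧ b i) (f i)) + sumFin m (λ i → when (not (c i) ∧ b i) (f i))
sumFin-when-split m b c f = trans (sumFin-cong m (λ i → when-split (b i) (c i) (f i))) (sumFin-+ m _ _)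

sumFin-𝟙-atMostOne : ∀ m (b : Fin m → Bool) Q →
                     (∀ i → b i ≡ true → Q ≡ true) →
                     (∀ i j → b i ≡ true → b j ≡ true → i ≡ j) →
                     sumFin m (λ i → 𝟙 (b i)) ≤ℚ 𝟙 Q
sumFin-𝟙-atMostOne zero    b Q b⇒Q unique = 𝟙-nonneg Q
sumFin-𝟙-atMostOne (suc m) b Q b⇒Q unique with b zero in b₀
... | false = ≤-trans (≤-reflexive (+-identityˡ _))
                      (sumFin-𝟙-atMostOne m (b ∘ suc) Q (b⇒Q ∘ suc) (λ i j p q → suc-injective (unique _ _ p q)))
... | true rewrite b⇒Q zero b₀ = ≤-trans (+-monoʳ-≤ 1ℚ rest-empty) (≤-reflexive (+-identityʳ 1ℚ))
  where
  rest-empty : sumFin m (λ i → 𝟙 (b (suc i))) ≤ℚ 0ℚ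
  rest-empty = sumFin-𝟙-atMostOne m (b ∘ suc) false
                 (λ i bᵢ → case unique zero (suc i) b₀ bᵢ of λ ())
                 (λ i j p q → suc-injective (unique _ _ p q))

-- Telescoping

inRange : ℕ → ℕ → ℕ → Bool
inRange lo hi j = (lo ℕ.≤ᵇ j) ∧ not (hi ℕ.≤ᵇ j)

<ᵇ-suc : ∀ m n → (m ℕ.<ᵇ suc n) ≡ (m ℕ.≤ᵇ n)
<ᵇ-suc zero    n = refl
<ᵇ-suc (suc m) n = refl

inRange-suc : ∀ lo hi j → inRange (suc lo) (suc hi) (suc j) ≡ inRange lo hi j
inRange-suc lo hi j = cong₂ (λ a b → a ∧ not b) (<ᵇ-suc lo j) (<ᵇ-suc hi j)

flipAt : ∀ {R} → (Fin (suc R) → Bool) → Fin R → ℚ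
flipAt B j = 𝟙 (B (Fin.inject₁ j) xor B (suc j))

flipsInRange : ∀ {R} → (Fin (suc R) → Bool) → ℕ → ℕ → ℚ
flipsInRange {R} B lo hi = sumFin R (λ j → when (inRange lo hi (Fin.toℕ j)) (flipAt B j))

flipsInRange-nonneg : ∀ {R} (B : Fin (suc R) → Bool) lo hi → 0ℚ ≤ℚ flipsInRange B lo hi
flipsInRange-nonneg {R} B lo hi =
  sumFin-nonneg R (λ j → when-nonneg (inRange lo hi (Fin.toℕ j)) (𝟙-nonneg _))

flipsInRange-suc : ∀ {R} (B : Fin (suc (suc R)) → Bool) lo hi →
                   flipsInRange B (suc lo) (suc hi) ≡ flipsInRange (B ∘ suc) lo hi
flipsInRange-suc {R} B lo hi =
  trans (+-identityˡ _) (sumFin-cong R (λ j → cong (λ b → when b _) (inRange-suc lo hi (Fin.toℕ j))))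

flipsInRange-zero : ∀ {R} (B : Fin (suc (suc R)) → Bool) hi →
                    flipsInRange B 0 (suc hi) ≡ flipAt B zero + flipsInRange (B ∘ suc) 0 hi
flipsInRange-zero {R} B hi =
  cong (flipAt B zero +_) (sumFin-cong R (λ j → cong (λ b → when b _) (inRange-suc 0 hi (Fin.toℕ j))))

𝟙-xor : ∀ a b → 𝟙 a ≤ℚ 𝟙 (a xor b) + 𝟙 b
𝟙-xor true  true  = ≤-reflexive (sym (+-identityˡ 1ℚ))
𝟙-xor true  false = ≤-reflexive (sym (+-identityʳ 1ℚ))
𝟙-xor false b     = p≤q⇒p≤r+q _ (𝟙-nonneg (false xor b)) (𝟙-nonneg b)

𝟙-telescope : ∀ R (B : Fin (suc R) → Bool) (lo hi : Fin (suc R)) → lo Fin.≤ hi →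
              𝟙 (B lo) ≤ℚ flipsInRange B (Fin.toℕ lo) (Fin.toℕ hi) + 𝟙 (B hi)
𝟙-telescope R       B zero     zero     _ =
  p≤q⇒p≤r+q (flipsInRange B 0 0) (flipsInRange-nonneg B 0 0) ≤-refl
𝟙-telescope (suc R) B zero     (suc hi) _ = begin
  𝟙 (B zero)                                   ≤⟨ 𝟙-xor (B zero) (B (suc zero)) ⟩
  flip₀ + 𝟙 (B (suc zero))                     ≤⟨ +-monoʳ-≤ flip₀ (𝟙-telescope R (B ∘ suc) zero hi ℕ.z≤n) ⟩
  flip₀ + (flips₁ + 𝟙 (B (suc hi)))            ≡⟨ +-assoc flip₀ flips₁ _ ⟨
  (flip₀ + flips₁) + 𝟙 (B (suc hi))            ≡⟨ cong (_+ 𝟙 (B (suc hi))) (flipsInRange-zero B (Fin.toℕ hi)) ⟨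
  flipsInRange B 0 (suc (Fin.toℕ hi)) + 𝟙 (B (suc hi)) ∎
  where
  open ≤-Reasoning
  flip₀ flips₁ : ℚ
  flip₀  = flipAt B zero
  flips₁ = flipsInRange (B ∘ suc) 0 (Fin.toℕ hi)
𝟙-telescope (suc R) B (suc lo) (suc hi) (ℕ.s≤s lo≤hi) =
  ≤-trans (𝟙-telescope R (B ∘ suc) lo hi lo≤hi)
          (≤-reflexive (cong (_+ 𝟙 (B (suc hi))) (sym (flipsInRange-suc B (Fin.toℕ lo) (Fin.toℕ hi)))))

-- Rationals with denominator 1

/1≡mkℚ : ∀ z → z / 1 ≡ mkℚ z 0 (Coprime-sym (1-coprimeTo ℤ.∣ z ∣))
/1≡mkℚ z = ↥p/↧p≡p (mkℚ z 0 _)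

+-/1 : ∀ z w → (z ℤ.+ w) / 1 ≡ z / 1 + w / 1
+-/1 z w rewrite /1≡mkℚ z | /1≡mkℚ w =
  cong₂ (λ a b → (a ℤ.+ b) / 1) (sym (ℤ.*-identityʳ z)) (sym (ℤ.*-identityʳ w))

-‿/1 : ∀ z → (ℤ.- z) / 1 ≡ - (z / 1)
-‿/1 z rewrite /1≡mkℚ z with z
... | ℤ.+0       = refl
... | ℤ.+[1+ n ] = ↥p/↧p≡p _
... | ℤ.-[1+ n ] = ↥p/↧p≡p _

sumFin-1 : ∀ m → sumFin m (λ _ → 1ℚ) ≡ ℤ.+ m / 1
sumFin-1 zero    = refl
sumFin-1 (suc m) = trans (cong (1ℚ +_) (sumFin-1 m)) (sym (+-/1 (ℤ.+ 1) (ℤ.+ m)))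

sumFin-𝟙-∣∣ : ∀ {m} (A : Subset m) → sumFin m (λ i → 𝟙 (lookup A i)) ≡ ℤ.+ ∣ A ∣ / 1
sumFin-𝟙-∣∣ []          = refl
sumFin-𝟙-∣∣ (true  ∷ A) = trans (cong (1ℚ +_) (sumFin-𝟙-∣∣ A)) (sym (+-/1 (ℤ.+ 1) (ℤ.+ ∣ A ∣)))
sumFin-𝟙-∣∣ (false ∷ A) = trans (+-identityˡ _) (sumFin-𝟙-∣∣ A)

+-cancelʳ-≤ : ∀ r {p q} → p + r ≤ℚ q + r → p ≤ℚ q
+-cancelʳ-≤ r {p} {q} p+r≤q+r = begin
  p               ≡⟨ //-rightDividesʳ r p ⟨
  (p + r) + - r   ≤⟨ +-monoˡ-≤ (- r) p+r≤q+r ⟩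
  (q + r) + - r   ≡⟨ //-rightDividesʳ r q ⟩
  q               ∎
  where open ≤-Reasoning

p≤q+r⇒p-r≤q : ∀ {p q} r → p ≤ℚ q + r → p + - r ≤ℚ q
p≤q+r⇒p-r≤q {q = q} r p≤q+r = ≤-trans (+-monoˡ-≤ (- r) p≤q+r) (≤-reflexive (//-rightDividesʳ r q))

-- Ancestry in a rooted tree

anyFin : (m : ℕ) → (Fin m → Bool) → Bool
anyFin zero    f = false
anyFin (suc m) f = f zero ∨ anyFin m (f ∘ suc)

anyFin-unique : {G : (m : ℕ) → (Fin m → Bool) → Bool} →
                (∀ f → G zero f ≡ false) → (∀ m f → G (suc m) f ≡ (f zero ∨ G m (f ∘ suc))) →
                ∀ m f → G m f ≡ anyFin m f
anyFin-unique     G-zero G-suc zero    f = G-zero f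
anyFin-unique {G} G-zero G-suc (suc m) f =
  trans (G-suc m f) (cong (f zero ∨_) (anyFin-unique {G} G-zero G-suc m (f ∘ suc)))

anyFin-intro : ∀ m (f : Fin m → Bool) i → f i ≡ true → anyFin m f ≡ true
anyFin-intro (suc m) f zero    fᵢ rewrite fᵢ = refl
anyFin-intro (suc m) f (suc i) fᵢ =
  trans (cong (f zero ∨_) (anyFin-intro m (f ∘ suc) i fᵢ)) (∨-zeroʳ (f zero))

anyFin-elim : ∀ m (f : Fin m → Bool) → anyFin m f ≡ true → ∃ λ i → f i ≡ true
anyFin-elim (suc m) f some with f zero in f₀
... | true  = zero , f₀
... | false = let i , fᵢ = anyFin-elim m (f ∘ suc) some in suc i , fᵢ

module _ (T : Tree) where
  open Tree T

  mutual
    depth-iter : ∀ m v → m ≤ depth v → depth (iter parent m v) ℕ.+ m ≡ depth v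
    depth-iter zero    v _   = ℕ.+-identityʳ (depth v)
    depth-iter (suc m) v m<d = begin
      depth (parent w) ℕ.+ suc m   ≡⟨ ℕ.+-suc _ m ⟩
      suc (depth (parent w)) ℕ.+ m ≡⟨ cong (ℕ._+ m) (depth-parent w (iter-nonroot m v m<d)) ⟨
      depth w ℕ.+ m                ≡⟨ depth-iter m v (ℕ.<⇒≤ m<d) ⟩
      depth v                      ∎
      where
      open ≡-Reasoning
      w : Node T
      w = iter parent m v

    iter-nonroot : ∀ m v → m < depth v → iter parent m v ≢ root
    iter-nonroot m v m<d w≡root = ℕ.<-irrefl m≡d m<d
      where
      m≡d : m ≡ depth v
      m≡d = trans (cong (ℕ._+ m) (sym depth-root))
                  (trans (cong (λ u → depth u ℕ.+ m) (sym w≡root)) (depth-iter m v (ℕ.<⇒≤ m<d)))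

  isAnc-iter : ∀ m v → m ≤ depth v → isAnc T (iter parent m v) v ≡ true
  isAnc-iter m v m≤d =
    cong₂ _∧_ (dec-true (iter parent (depth v ℕ.∸ depth u) v Fin.≟ u) iter-u)
              (dec-true (depth u ℕ.≤? depth v) (subst (depth u ≤_) u+m≡v (ℕ.m≤m+n (depth u) m)))
    where
    u : Node T
    u = iter parent m v
    u+m≡v : depth u ℕ.+ m ≡ depth v
    u+m≡v = depth-iter m v m≤d
    iter-u : iter parent (depth v ℕ.∸ depth u) v ≡ u
    iter-u = cong (λ d → iter parent d v)
                  (trans (cong (ℕ._∸ depth u) (sym u+m≡v)) (ℕ.m+n∸m≡n (depth u) m))

  isAnc⇒iter-depth : ∀ {u v} → isAnc T u v ≡ true → iter parent (depth v ℕ.∸ depth u) v ≡ u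
  isAnc⇒iter-depth {u} u≼v = from-does (_ Fin.≟ u) (∧-conicalˡ _ _ u≼v)

  isAnc⇒iter : ∀ {u v} → isAnc T u v ≡ true → ∃ λ m → m ≤ depth v × iter parent m v ≡ u
  isAnc⇒iter {u} {v} u≼v = depth v ℕ.∸ depth u , ℕ.m∸n≤m (depth v) (depth u) , isAnc⇒iter-depth u≼v

  isAnc-refl : ∀ v → isAnc T v v ≡ true
  isAnc-refl v = isAnc-iter 0 v ℕ.z≤n

  isAnc-parent : ∀ {v ℓ} → isAnc T v ℓ ≡ true → v ≢ root → isAnc T (parent v) ℓ ≡ true
  isAnc-parent {v} {ℓ} v≼ℓ v≢root with isAnc⇒iter v≼ℓ
  ... | m , m≤d , refl = isAnc-iter (suc m) ℓ m<d
    where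
    m<d : m < depth ℓ
    m<d = subst (m <_) (trans (cong (ℕ._+ m) (sym (depth-parent _ v≢root))) (depth-iter m ℓ m≤d))
                (ℕ.s≤s (ℕ.m≤n+m m _))

  isAnc-sibling-unique : ∀ {v v′ x} → v ≢ root → v′ ≢ root → parent v ≡ parent v′ →
                         isAnc T v x ≡ true → isAnc T v′ x ≡ true → v ≡ v′
  isAnc-sibling-unique {v} {v′} {x} v≢root v′≢root siblings v≼x v′≼x =
    trans (sym (isAnc⇒iter-depth v≼x))
          (trans (cong (λ d → iter parent (depth x ℕ.∸ d) x) same-depth) (isAnc⇒iter-depth v′≼x))
    where
    same-depth : depth v ≡ depth v′
    same-depth = trans (depth-parent v v≢root)
                       (trans (cong (suc ∘ depth) siblings) (sym (depth-parent v′ v′≢root)))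

  isAnc-strict⇒¬Leaf : ∀ {v ℓ} → isAnc T v ℓ ≡ true → ℓ ≢ v → ¬ Leaf T v
  isAnc-strict⇒¬Leaf v≼ℓ ℓ≢v leaf with isAnc⇒iter v≼ℓ
  ... | zero  , _   , ℓ≡v   = ℓ≢v ℓ≡v
  ... | suc m , m<d , p[w]≡v = leaf _ (iter-nonroot m _ m<d) p[w]≡v

  -- inTA folds with a local function that cannot be named; abstracting its arguments with `with`
  -- lets unification identify it with anyFin through its defining equations.
  inTA≡anyFin : ∀ A v → inTA T A v ≡ anyFin n (λ ℓ → lookup A ℓ ∧ isAnc T v ℓ)
  inTA≡anyFin A v
    with n | (λ ℓ → lookup A ℓ ∧ isAnc T v ℓ) | anyFin-unique {G = _} (λ _ → refl) (λ _ _ → refl)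
  ... | m | f | G≡anyFin = G≡anyFin m f

  inTA-intro : ∀ A {v ℓ} → lookup A ℓ ≡ true → isAnc T v ℓ ≡ true → inTA T A v ≡ true
  inTA-intro A {v} {ℓ} ℓ∈A v≼ℓ =
    trans (inTA≡anyFin A v) (anyFin-intro n (λ ℓ → lookup A ℓ ∧ isAnc T v ℓ) ℓ (cong₂ _∧_ ℓ∈A v≼ℓ))

  inTA-elim : ∀ A {v} → inTA T A v ≡ true → ∃ λ ℓ → lookup A ℓ ≡ true × isAnc T v ℓ ≡ true
  inTA-elim A {v} v∈TA with anyFin-elim n _ (trans (sym (inTA≡anyFin A v)) v∈TA)
  ... | ℓ , ℓ∈A∧v≼ℓ =
    ℓ , ∧-conicalˡ (lookup A ℓ) _ ℓ∈A∧v≼ℓ , ∧-conicalʳ (lookup A ℓ) _ ℓ∈A∧v≼ℓ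

  inTA-parent : ∀ A {v} → inTA T A v ≡ true → v ≢ root → inTA T A (parent v) ≡ true
  inTA-parent A v∈TA v≢root with inTA-elim A v∈TA
  ... | ℓ , ℓ∈A , v≼ℓ = inTA-intro A ℓ∈A (isAnc-parent v≼ℓ v≢root)

  isChild : Node T → Node T → Bool
  isChild v u = not (isRoot T v) ∧ does (u Fin.≟ parent v)

  isChild⇒ : ∀ {v u} → isChild v u ≡ true → v ≢ root × u ≡ parent v
  isChild⇒ {v} {u} v◁u = from-not-does (v Fin.≟ root) (∧-conicalˡ _ _ v◁u)
                       , from-does (u Fin.≟ parent v) (∧-conicalʳ (not (isRoot T v)) _ v◁u)

  sumFin-children-𝟙 : ∀ u x → sumFin n (λ v → 𝟙 (isChild v u ∧ isAnc T v x)) ≤ℚ 𝟙 (isAnc T u x)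
  sumFin-children-𝟙 u x = sumFin-𝟙-atMostOne n (λ v → isChild v u ∧ isAnc T v x) (isAnc T u x) u≼x unique
    where
    u≼x : ∀ v → isChild v u ∧ isAnc T v x ≡ true → isAnc T u x ≡ true
    u≼x v b with isChild⇒ {v} {u} (∧-conicalˡ _ _ b)
    ... | v≢root , refl = isAnc-parent (∧-conicalʳ (isChild v u) _ b) v≢root
    unique : ∀ v v′ → isChild v u ∧ isAnc T v x ≡ true → isChild v′ u ∧ isAnc T v′ x ≡ true → v ≡ v′
    unique v v′ b b′ with isChild⇒ {v} {u} (∧-conicalˡ _ _ b) | isChild⇒ {v′} {u} (∧-conicalˡ _ _ b′)
    ... | v≢root , u≡pv | v′≢root , u≡pv′ =
      isAnc-sibling-unique v≢root v′≢root (trans (sym u≡pv) u≡pv′)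
                           (∧-conicalʳ (isChild v u) _ b) (∧-conicalʳ (isChild v′ u) _ b′)

  ≤ₜ⇒≤ : ∀ {R N} (a b : Timestep T R N) → _≤ₜ_ T a b ≡ true → proj₁ a Fin.≤ proj₁ b
  ≤ₜ⇒≤ (ja , _) (jb , _) a≤b =
    ℕ.≮⇒≥ (from-not-does (jb Fin.<? ja) (not-∨ˡ (does (jb Fin.<? ja)) a≤b))

  request-in-interval : ∀ {R N} (a b : Timestep T R (suc N)) j →
                        (_<ₜ_ T a (j , zero) ∧ _≤ₜ_ T (j , zero) b)
                        ≡ inRange (suc (Fin.toℕ (proj₁ a))) (suc (Fin.toℕ (proj₁ b))) (Fin.toℕ j)
  request-in-interval (ja , _) (jb , _) j =
    cong₂ (λ p q → p ∧ not q) (∨-∧-false (does (ja Fin.<? j)) (does (ja Fin.≟ j)))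
                              (∨-∧-false (does (jb Fin.<? j)) (does (jb Fin.≟ j)))

-- The LP solution induced by a k-server solution

module _ (T : Tree) {k R : ℕ} {req : Fin R → Node T} (S : Solution T k R req) where
  open Tree T
  open Solution S

  inSubtree : Node T → Fin k → Fin (suc R) → Bool
  inSubtree v s i = isAnc T v (conf i s)

  occupancy : Node T → Fin (suc R) → ℚ
  occupancy v i = sumFin k (λ s → 𝟙 (inSubtree v s i))

  crossings : Node T → Fin R → ℚ
  crossings v j = sumFin k (λ s → flipAt (inSubtree v s) j)

  crossingLP : ∀ {N} → LPVar T R N
  crossingLP v (j , zero)  = crossings v j
  crossingLP v (j , suc _) = 0ℚ

  crossingLP-nonneg : ∀ {N} v (t : Timestep T R N) → 0ℚ ≤ℚ crossingLP v t
  crossingLP-nonneg v (j , zero)  = sumFin-nonneg k (λ s → 𝟙-nonneg _)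
  crossingLP-nonneg v (j , suc _) = ≤-refl

  sumFin-when-crossingLP : ∀ {N} (b : Fin (suc N) → Bool) v j →
                           sumFin (suc N) (λ i → when (b i) (crossingLP v (j , i))) ≡ when (b zero) (crossings v j)
  sumFin-when-crossingLP {N} b v j =
    trans (cong (when (b zero) (crossings v j) +_)
                (trans (sumFin-cong N (λ i → when-zero (b (suc i)))) (sumFin-zero N)))
          (+-identityʳ _)

  objective-crossingLP : ∀ {N} c → objective T c (crossingLP {suc N}) ≡ cost T c S
  objective-crossingLP {N} c = begin
    objective T c (crossingLP {suc N})
      ≡⟨ sumFin-cong n node-cost ⟩
    sumFin n (λ v → sumFin R (λ j → sumFin k (λ s → when (moves v j s) (c v))))
      ≡⟨ sumFin-swap n R _ ⟩
    sumFin R (λ j → sumFin n (λ v → sumFin k (λ s → when (moves v j s) (c v))))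
      ≡⟨ sumFin-cong R (λ j → sumFin-swap n k _) ⟩
    cost T c S ∎
    where
    open ≡-Reasoning
    moves : Node T → Fin R → Fin k → Bool
    moves v j s = not (isRoot T v) ∧ (inSubtree v s (Fin.inject₁ j) xor inSubtree v s (suc j))

    step-cost : ∀ v j → when (not (isRoot T v)) (sumFin (suc N) (λ i → c v * crossingLP v (j , i)))
                        ≡ sumFin k (λ s → when (moves v j s) (c v))
    step-cost v j = begin
      when nr (sumFin (suc N) (λ i → c v * crossingLP v (j , i)))
        ≡⟨ cong (when nr) (sumFin-*ˡ (suc N) (c v) (λ i → crossingLP v (j , i))) ⟨
      when nr (c v * sumFin (suc N) (λ i → crossingLP v (j , i)))
        ≡⟨ cong (λ q → when nr (c v * q)) (sumFin-when-crossingLP {N} (λ _ → true) v j) ⟩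
      when nr (c v * crossings v j)
        ≡⟨ cong (when nr) (sumFin-*ˡ k (c v) _) ⟩
      when nr (sumFin k (λ s → c v * flipAt (inSubtree v s) j))
        ≡⟨ when-sumFin k nr _ ⟩
      sumFin k (λ s → when nr (c v * flipAt (inSubtree v s) j))
        ≡⟨ sumFin-cong k (λ s → when-*-𝟙 nr _ (c v)) ⟩
      sumFin k (λ s → when (moves v j s) (c v)) ∎
      where
      nr : Bool
      nr = not (isRoot T v)

    node-cost : ∀ v → when (not (isRoot T v)) (sumFin R (λ j → sumFin (suc N) (λ i → c v * crossingLP v (j , i))))
                      ≡ sumFin R (λ j → sumFin k (λ s → when (moves v j s) (c v)))
    node-cost v = trans (when-sumFin R _ _) (sumFin-cong R (step-cost v))

  xInt-crossingLP : ∀ {N} v (a b : Timestep T R (suc N)) →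
                    xInt T crossingLP v a b
                    ≡ sumFin k (λ s → flipsInRange (inSubtree v s) (suc (Fin.toℕ (proj₁ a))) (suc (Fin.toℕ (proj₁ b))))
  xInt-crossingLP {N} v a b = begin
    xInt T crossingLP v a b
      ≡⟨ sumFin-cong R (λ j → sumFin-when-crossingLP {N} (λ i → _<ₜ_ T a (j , i) ∧ _≤ₜ_ T (j , i) b) v j) ⟩
    sumFin R (λ j → when (_<ₜ_ T a (j , zero) ∧ _≤ₜ_ T (j , zero) b) (crossings v j))
      ≡⟨ sumFin-cong R (λ j → cong (λ w → when w (crossings v j)) (request-in-interval T a b j)) ⟩
    sumFin R (λ j → when (window j) (crossings v j))
      ≡⟨ sumFin-cong R (λ j → when-sumFin k (window j) _) ⟩
    sumFin R (λ j → sumFin k (λ s → when (window j) (flipAt (inSubtree v s) j)))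
      ≡⟨ sumFin-swap R k _ ⟩
    sumFin k (λ s → flipsInRange (inSubtree v s) (suc (Fin.toℕ (proj₁ a))) (suc (Fin.toℕ (proj₁ b)))) ∎
    where
    open ≡-Reasoning
    window : Fin R → Bool
    window j = inRange (suc (Fin.toℕ (proj₁ a))) (suc (Fin.toℕ (proj₁ b))) (Fin.toℕ j)

  occupancy-≤-xInt : ∀ {N} v (a b : Timestep T R (suc N)) → proj₁ a Fin.≤ proj₁ b →
                     occupancy v (suc (proj₁ a)) ≤ℚ xInt T crossingLP v a b + occupancy v (suc (proj₁ b))
  occupancy-≤-xInt v a b a≤b =
    ≤-trans (sumFin-mono k (λ s → 𝟙-telescope R (inSubtree v s) (suc (proj₁ a)) (suc (proj₁ b)) (ℕ.s≤s a≤b)))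
            (≤-reflexive (trans (sumFin-+ k _ _)
                                (cong (_+ occupancy v (suc (proj₁ b))) (sym (xInt-crossingLP v a b)))))

  occupancy-served : ∀ j → 1ℚ ≤ℚ occupancy (req j) (suc j)
  occupancy-served j with serves j
  ... | s , conf≡req = ≤-trans (≤-reflexive (cong 𝟙 (sym s-at-request))) (term≤sumFin k (λ _ → 𝟙-nonneg _) s)
    where
    s-at-request : inSubtree (req j) s (suc j) ≡ true
    s-at-request = subst (λ ℓ → isAnc T (req j) ℓ ≡ true) (sym conf≡req) (isAnc-refl T (req j))

  occupancy≤k : ∀ v i → occupancy v i ≤ℚ ℤ.+ k / 1
  occupancy≤k v i = ≤-trans (sumFin-mono k (λ s → when-≤ (inSubtree v s i) 0≤1)) (≤-reflexive (sumFin-1 k))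

  sumFin-children-occupancy : ∀ u i → sumFin n (λ v → when (isChild T v u) (occupancy v i)) ≤ℚ occupancy u i
  sumFin-children-occupancy u i = begin
    sumFin n (λ v → when (isChild T v u) (occupancy v i))
      ≡⟨ sumFin-cong n (λ v → when-sumFin k _ _) ⟩
    sumFin n (λ v → sumFin k (λ s → when (isChild T v u) (𝟙 (inSubtree v s i))))
      ≡⟨ sumFin-cong n (λ v → sumFin-cong k (λ s → when-when (isChild T v u) _ 1ℚ)) ⟩
    sumFin n (λ v → sumFin k (λ s → 𝟙 (isChild T v u ∧ inSubtree v s i)))
      ≡⟨ sumFin-swap n k _ ⟩
    sumFin k (λ s → sumFin n (λ v → 𝟙 (isChild T v u ∧ inSubtree v s i)))
      ≤⟨ sumFin-mono k (λ s → sumFin-children-𝟙 T u (conf i s)) ⟩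
    occupancy u i ∎
    where open ≤-Reasoning

  module _ {N} (A : Subset n) (τ : Node T → Timestep T R (suc N)) (valid : ValidPair T req A τ) where

    private
      A⊆leaves : ∀ ℓ → ℓ ∈ A → Leaf T ℓ
      A⊆leaves = proj₁ valid

      A-requested : ∀ ℓ → ℓ ∈ A → req (proj₁ (τ ℓ)) ≡ ℓ
      A-requested = proj₁ (proj₂ valid)

      τ-dominates : ∀ u → inTA T A u ≡ true → ¬ Leaf T u →
                    ∀ ℓ → ℓ ∈ A → isAnc T u ℓ ≡ true → _≤ₜ_ T (τ ℓ) (τ u) ≡ true
      τ-dominates u u∈TA internal = proj₁ (proj₂ (proj₂ valid) u u∈TA internal)

      τ-attained : ∀ u → inTA T A u ≡ true → ¬ Leaf T u →
                   ∃ λ ℓ → ℓ ∈ A × isAnc T u ℓ ≡ true × τ ℓ ≡ τ u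
      τ-attained u u∈TA internal = proj₂ (proj₂ (proj₂ valid) u u∈TA internal)

      occupancyAt : Node T → Timestep T R (suc N) → ℚ
      occupancyAt v t = occupancy v (suc (proj₁ t))

      inA : Node T → Bool
      inA = lookup A

      edge : Node T → Bool
      edge v = not (isRoot T v) ∧ inTA T A v

    edge⇒ : ∀ {v} → edge v ≡ true → v ≢ root × inTA T A v ≡ true
    edge⇒ {v} e = from-not-does (v Fin.≟ root) (∧-conicalˡ _ _ e) , ∧-conicalʳ (not (isRoot T v)) _ e

    parent∉A : ∀ v → v ≢ root → inA (parent v) ≡ false
    parent∉A v v≢root with inA (parent v) in p[v]∈A
    ... | false = refl
    ... | true  = ⊥-elim (A⊆leaves (parent v) (lookup⇒[]= _ A p[v]∈A) v v≢root refl)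

    parent-of-edge : ∀ {u v} → does (u Fin.≟ parent v) ∧ edge v ≡ true →
                     (not (inA u) ∧ inTA T A u) ∧ isChild T v u ≡ true
    parent-of-edge {u} {v} h
      with from-does (u Fin.≟ parent v) (∧-conicalˡ _ _ h) | edge⇒ {v} (∧-conicalʳ (does (u Fin.≟ parent v)) _ h)
    ... | refl | v≢root , v∈TA =
      cong₂ _∧_ (cong₂ _∧_ (cong not (parent∉A v v≢root)) (inTA-parent T A v∈TA v≢root))
                (cong₂ _∧_ (cong not (dec-false (v Fin.≟ root) v≢root)) (dec-true (parent v Fin.≟ parent v) refl))

    τ-below-parent : ∀ {v ℓ} → v ≢ root → inTA T A v ≡ true → ℓ ∈ A → isAnc T (parent v) ℓ ≡ true →
                     _≤ₜ_ T (τ ℓ) (τ (parent v)) ≡ true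
    τ-below-parent {v} v≢root v∈TA =
      τ-dominates (parent v) (inTA-parent T A v∈TA v≢root) (λ leaf → leaf v v≢root refl) _

    τ-mono : ∀ {v} → v ≢ root → inTA T A v ≡ true → _≤ₜ_ T (τ v) (τ (parent v)) ≡ true
    τ-mono {v} v≢root v∈TA with inA v in v∈?A
    ... | true  = τ-below-parent v≢root v∈TA (lookup⇒[]= v A v∈?A) (isAnc-parent T (isAnc-refl T v) v≢root)
    ... | false with inTA-elim T A v∈TA
    ... | ℓ , ℓ∈A , v≼ℓ with τ-attained v v∈TA (isAnc-strict⇒¬Leaf T v≼ℓ ℓ≢v)
      where
      ℓ≢v : ℓ ≢ v
      ℓ≢v refl = case trans (sym ℓ∈A) v∈?A of λ ()
    ... | ℓ′ , ℓ′∈A , v≼ℓ′ , τℓ′≡τv =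
      subst (λ t → _≤ₜ_ T t (τ (parent v)) ≡ true) τℓ′≡τv
            (τ-below-parent v≢root v∈TA ℓ′∈A (isAnc-parent T v≼ℓ′ v≢root))

    private
      LHS K W : ℚ
      LHS = constraintLHS T crossingLP A τ
      K   = ℤ.+ k / 1
      W   = sumFin n (λ u → when (not (inA u) ∧ inTA T A u) (occupancyAt u (τ u)))

    edges-≤ : sumFin n (λ v → when (edge v) (occupancyAt v (τ v)))
              ≤ℚ LHS + sumFin n (λ v → when (edge v) (occupancyAt v (τ (parent v))))
    edges-≤ = ≤-trans (sumFin-mono n (λ v → when-≤-+ (edge v) (edge-≤ ∘ edge⇒))) (≤-reflexive (sumFin-+ n _ _))
      where
      edge-≤ : ∀ {v} → v ≢ root × inTA T A v ≡ true →
               occupancyAt v (τ v) ≤ℚ xInt T crossingLP v (τ v) (τ (parent v)) + occupancyAt v (τ (parent v))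
      edge-≤ {v} (v≢root , v∈TA) =
        occupancy-≤-xInt v (τ v) (τ (parent v)) (≤ₜ⇒≤ T (τ v) (τ (parent v)) (τ-mono v≢root v∈TA))

    children-≤ : sumFin n (λ v → when (edge v) (occupancyAt v (τ (parent v)))) ≤ℚ W
    children-≤ = begin
      sumFin n (λ v → when (edge v) (occupancyAt v (τ (parent v))))
        ≡⟨ sumFin-cong n (λ v → sumFin-when-≟ n (parent v) (λ u → when (edge v) (occupancyAt v (τ u)))) ⟨
      sumFin n (λ v → sumFin n (λ u → when (does (u Fin.≟ parent v)) (when (edge v) (occupancyAt v (τ u)))))
        ≡⟨ sumFin-swap n n _ ⟩
      sumFin n (λ u → sumFin n (λ v → when (does (u Fin.≟ parent v)) (when (edge v) (occupancyAt v (τ u)))))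
        ≤⟨ sumFin-mono n (λ u → ≤-trans (sumFin-mono n (child-term u)) (≤-reflexive (sym (when-sumFin n _ _)))) ⟩
      sumFin n (λ u → when (not (inA u) ∧ inTA T A u) (sumFin n (λ v → when (isChild T v u) (occupancyAt v (τ u)))))
        ≤⟨ sumFin-mono n (λ u → when-mono-≤ (not (inA u) ∧ inTA T A u) (sumFin-children-occupancy u _)) ⟩
      W ∎
      where
      open ≤-Reasoning
      child-term : ∀ u v → when (does (u Fin.≟ parent v)) (when (edge v) (occupancyAt v (τ u)))
                           ≤ℚ when (not (inA u) ∧ inTA T A u) (when (isChild T v u) (occupancyAt v (τ u)))
      child-term u v = begin
        when (does (u Fin.≟ parent v)) (when (edge v) q)         ≡⟨ when-when (does (u Fin.≟ parent v)) (edge v) q ⟩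
        when (does (u Fin.≟ parent v) ∧ edge v) q               ≤⟨ when-⇒-≤ _ _ 0≤q parent-of-edge ⟩
        when ((not (inA u) ∧ inTA T A u) ∧ isChild T v u) q      ≡⟨ when-when (not (inA u) ∧ inTA T A u) _ q ⟨
        when (not (inA u) ∧ inTA T A u) (when (isChild T v u) q) ∎
        where
        q : ℚ
        q = occupancyAt v (τ u)
        0≤q : 0ℚ ≤ℚ q
        0≤q = sumFin-nonneg k (λ s → 𝟙-nonneg _)

    root-≤ : sumFin n (λ v → when (isRoot T v ∧ inTA T A v) (occupancyAt v (τ v))) ≤ℚ K
    root-≤ = begin
      sumFin n (λ v → when (isRoot T v ∧ inTA T A v) (occupancyAt v (τ v)))
        ≡⟨ sumFin-cong n (λ v → when-when (isRoot T v) (inTA T A v) _) ⟨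
      sumFin n (λ v → when (isRoot T v) (when (inTA T A v) (occupancyAt v (τ v))))
        ≡⟨ sumFin-when-≟ n root _ ⟩
      when (inTA T A root) (occupancyAt root (τ root))
        ≤⟨ when-≤ (inTA T A root) (sumFin-nonneg k (λ s → 𝟙-nonneg _)) ⟩
      occupancyAt root (τ root)
        ≤⟨ occupancy≤k root _ ⟩
      K ∎
      where open ≤-Reasoning

    leaves-≤ : sumFin n (λ v → 𝟙 (inA v)) ≤ℚ sumFin n (λ v → when (inA v ∧ inTA T A v) (occupancyAt v (τ v)))
    leaves-≤ = sumFin-mono n leaf-≤
      where
      leaf-≤ : ∀ v → 𝟙 (inA v) ≤ℚ when (inA v ∧ inTA T A v) (occupancyAt v (τ v))
      leaf-≤ v with inA v in v∈A
      ... | false = ≤-refl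
      ... | true rewrite inTA-intro T A v∈A (isAnc-refl T v) =
        subst (λ ℓ → 1ℚ ≤ℚ occupancy ℓ (suc (proj₁ (τ v)))) (A-requested v (lookup⇒[]= v A v∈A))
              (occupancy-served (proj₁ (τ v)))

    crossingLP-constraint : (ℤ.+ ∣ A ∣ ℤ.- ℤ.+ k) / 1 ≤ℚ constraintLHS T crossingLP A τ
    crossingLP-constraint = begin
      (ℤ.+ ∣ A ∣ ℤ.- ℤ.+ k) / 1
        ≡⟨ trans (+-/1 (ℤ.+ ∣ A ∣) (ℤ.- ℤ.+ k)) (cong₂ _+_ (sym (sumFin-𝟙-∣∣ A)) (-‿/1 (ℤ.+ k))) ⟩
      |A| + - K
        ≤⟨ p≤q+r⇒p-r≤q {|A|} K (+-cancelʳ-≤ W counted) ⟩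
      LHS ∎
      where
      open ≤-Reasoning
      |A| : ℚ
      |A| = sumFin n (λ v → 𝟙 (inA v))
      counted : |A| + W ≤ℚ (LHS + K) + W
      counted = begin
        |A| + W
          ≤⟨ +-monoˡ-≤ W leaves-≤ ⟩
        sumFin n (λ v → when (inA v ∧ inTA T A v) (occupancyAt v (τ v))) + W
          ≡⟨ sumFin-when-split n (inTA T A) inA _ ⟨
        sumFin n (λ v → when (inTA T A v) (occupancyAt v (τ v)))
          ≡⟨ sumFin-when-split n (inTA T A) (isRoot T) _ ⟩
        sumFin n (λ v → when (isRoot T v ∧ inTA T A v) (occupancyAt v (τ v)))
          + sumFin n (λ v → when (edge v) (occupancyAt v (τ v)))
          ≤⟨ +-mono-≤ root-≤ (≤-trans edges-≤ (+-monoʳ-≤ LHS children-≤)) ⟩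
        K + (LHS + W)
          ≡⟨ trans (sym (+-assoc K LHS W)) (cong (_+ W) (+-comm K LHS)) ⟩
        (LHS + K) + W ∎

  crossingLP-feasible : ∀ {N} → Feasible T k req (crossingLP {suc N})
  crossingLP-feasible = crossingLP-nonneg , crossingLP-constraint

claim2p1 : (T : Tree) (c : Node T → ℚ) → IsHST T c →
           (k R : ℕ) (req : Fin R → Node T) → (∀ j → Leaf T (req j)) →
           (N : ℕ) → 2 ≤ N →
           (S : Solution T k R req) →
           Σ (LPVar T R N) (λ x → Feasible T k req x × (objective T c x ≤ℚ cost T c S))
claim2p1 T c _ k R req _ (suc N) (ℕ.s≤s _) S =
  crossingLP T S , crossingLP-feasible T S , ≤-reflexive (objective-crossingLP T S {N} c)
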